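{- (i) For every integer $n\ge0$ and all $X,Y\in\mathbb{C}$, $$(X+Y)^{S_2(n)}=\sum_{\substack{0\le k\le n\\ S_2(k)+S_2(n-k)=S_2(n)}}X^{S_2(k)}Y^{S_2(n-k)}.$$ (ii) For every integer $n\ge0$ and all $X,Y\in\mathbb{C}$, $$(X+Y)^{S_3(n)}=\sum_{\substack{0\le k\le n\\ S_3(k)+S_3(n-k)=S_3(n)}}2^{\,S_3^{(2)}(n)-S_3^{(2)}(k)-S_3^{(2)}(n-k)}\,X^{S_3(k)}Y^{S_3(n-k)}.$$
   Context: For an integer base $b\ge2$ and $m\ge0$ with base-$b$ digits $m_l\in\{0,\dots,b-1\}$ ($m=\sum_lm_lb^l$), $S_b(m)=\sum_l m_l$ is the digit sum and $S_b^{(j)}(m)$ is the number of digits of $m$ equal to $j$. Convention $0^0=1$. -}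

module Defs where

open import Level using (Level)
open import Data.Nat using (ℕ; zero; suc; _≟_; NonZero)
open import Data.Nat.ListAction using (sum)
open import Data.Nat.DivMod using (_/_; _%_)
open import Data.List using (List; []; _∷_; length; filter; map; upTo; foldr)
open import Data.Bool using (if_then_else_)
open import Relation.Nullary.Decidable using (⌊_⌋)
open import Algebra.Bundles using (CommutativeRing)

-- Base-b digits of m, least significant first (no leading zeros; digits 0 = []).
-- Uses fuel: m itself suffices for b ≥ 2 since m / b < m for m > 0.
digitsFuel : ℕ → (b : ℕ) → .{{NonZero b}} → ℕ → List ℕ
digitsFuel zero    b m = []
digitsFuel (suc f) b m = if ⌊ m ≟ 0 ⌋ then [] else ((m % b) ∷ digitsFuel f b (m / b))

digits : (b : ℕ) → .{{NonZero b}} → ℕ → List ℕ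
digits b m = digitsFuel m b m

S : (b : ℕ) → .{{NonZero b}} → ℕ → ℕ
S b m = sum (digits b m)

Scount : (b : ℕ) → .{{NonZero b}} → ℕ → ℕ → ℕ
Scount b j m = length (filter (λ d → d ≟ j) (digits b m))

range0to : ℕ → List ℕ
range0to n = upTo (suc n)

module _ {c ℓ : Level} (R : CommutativeRing c ℓ) where
  open CommutativeRing R

  -- x ^ n with the convention x ^ 0 = 1 (so 0^0 = 1)
  pow : Carrier → ℕ → Carrier
  pow x zero    = 1#
  pow x (suc n) = x * pow x n

  ringSum : List Carrier → Carrier
  ringSum = foldr _+_ 0#

  two : Carrier
  two = 1# + 1#

-- Write n = r + q b and k = j + k′ b with r, j < b.  If j ≤ r, then n ∸ k = (r ∸ j) + (q ∸ k′) b, so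
-- S k + S (n ∸ k) = S n holds for k exactly when it holds for k′ and q.  If j > r, the last digits of k
-- and n ∸ k add up to b + r, while subadditivity gives S q ≤ 1 + S k′ + S (q ∸ suc k′); hence
-- S k + S (n ∸ k) ≥ S n + b − 1 and the condition fails.  So the sum over admissible k ≤ n factors as
-- (sum over admissible k′ ≤ q) × (sum over j ≤ r) as soon as the summand factors digitwise, and
-- induction on the digits of n reduces the identity to single digits r < b.  There it is the binomial
-- theorem for (X + Y) ^ r with r ≤ 2: on one digit, the weight 2 ^ (S⁽²⁾ n ∸ S⁽²⁾ k ∸ S⁽²⁾ (n ∸ k)) is
-- the binomial coefficient (r choose j).  The digitwise factorisation of that weight needs
-- S⁽²⁾ k + S⁽²⁾ (n ∸ k) ≤ S⁽²⁾ n, proved by the same induction.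
module Submission where

open import Defs
open import Level using (Level)
open import Algebra.Bundles using (CommutativeRing)
open import Data.Bool using (true; false; if_then_else_)
open import Data.Empty using (⊥-elim)
open import Data.List using (_∷_; length; map; filter; applyUpTo)
open import Data.Product using (_×_; _,_)
open import Data.Sum using (_⊎_; inj₁; inj₂; [_,_]′)
open import Data.Maybe using (nothing)
open import Tactic.RingSolver.Core.AlmostCommutativeRing using (fromCommutativeRing)
open import Function using (id; _∘_; _⇔_; mk⇔; Equivalence)
open import Relation.Nullary using (Dec; yes; no; does; ¬_)
import Relation.Binary.PropositionalEquality as ≡
open import Data.Nat using (ℕ; zero; suc; _≤_; _<_; _∸_; _≟_; z≤n; s≤s)
import Data.Nat as ℕ

δ : ℕ → ℕ → ℕ
δ d x = if does (x ≟ d) then 1 else 0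

module Digits (k : ℕ) where
  open ≡
  open import Data.Nat
  open import Data.Nat.DivMod
  open import Data.Nat.Divisibility using (n∣m*n)
  open import Data.Nat.Induction using (<-rec)
  open import Data.Nat.ListAction using (sum)
  open import Data.Nat.Properties
  open import Data.Nat.Tactic.RingSolver using (solve-∀)
  open import Algebra.Properties.CommutativeSemigroup +-commutativeSemigroup
    using () renaming (interchange to +-interchange)

  b : ℕ
  b = 2 + k

  1<b : 1 < b
  1<b = s≤s (s≤s z≤n)

  private
    split : ∀ c i j m n → c + (i + m * b) + (j + n * b) ≡ (c + i + j) + (m + n) * b
    split c i j m n = lemma c i j m n b
      where
      lemma : ∀ c i j m n B → c + (i + m * B) + (j + n * B) ≡ (c + i + j) + (m + n) * B
      lemma = solve-∀

    regroup : ∀ c i j x y → (c + i + j) + (x + y) ≡ c + ((i + x) + (j + y))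
    regroup = solve-∀

    digits-+ : ∀ j k′ u d → (j + k′ * b) + (u + d * b) ≡ (j + u) + (k′ + d) * b
    digits-+ j k′ u d = lemma j k′ u d b
      where
      lemma : ∀ j k′ u d B → (j + k′ * B) + (u + d * B) ≡ (j + u) + (k′ + d) * B
      lemma = solve-∀

    ∸-by-+ : ∀ k {l n} → k + l ≡ n → n ∸ k ≡ l
    ∸-by-+ k {l} refl = m+n∸m≡n k l

  digitsFuel-enough : ∀ f g m → m ≤ f → m ≤ g → digitsFuel f b m ≡ digitsFuel g b m
  digitsFuel-enough zero    zero    m       _        _        = refl
  digitsFuel-enough zero    (suc g) zero    _        _        = refl
  digitsFuel-enough (suc f) zero    zero    _        _        = refl
  digitsFuel-enough (suc f) (suc g) zero    _        _        = refl
  digitsFuel-enough (suc f) (suc g) (suc m) (s≤s m≤f) (s≤s m≤g) =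
    cong (suc m % b ∷_) (digitsFuel-enough f g (suc m / b) (≤-trans q≤m m≤f) (≤-trans q≤m m≤g))
    where
    q≤m : suc m / b ≤ m
    q≤m = ≤-pred (m/n<m (suc m) b 1<b)

  digits-suc : ∀ m → digits b (suc m) ≡ suc m % b ∷ digits b (suc m / b)
  digits-suc m = cong (suc m % b ∷_)
    (digitsFuel-enough m (suc m / b) (suc m / b) (≤-pred (m/n<m (suc m) b 1<b)) ≤-refl)

  S-step : ∀ m → S b m ≡ m % b + S b (m / b)
  S-step zero    = refl
  S-step (suc m) = cong sum (digits-suc m)

  count-∷ : ∀ d x xs → length (filter (_≟ d) (x ∷ xs)) ≡ δ d x + length (filter (_≟ d) xs)
  count-∷ d x xs with does (x ≟ d)
  ... | true  = refl
  ... | false = refl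

  Scount-step : ∀ d m → Scount b (suc d) m ≡ δ (suc d) (m % b) + Scount b (suc d) (m / b)
  Scount-step d zero    = refl
  Scount-step d (suc m) =
    trans (cong (length ∘ filter (_≟ suc d)) (digits-suc m)) (count-∷ (suc d) (suc m % b) _)

  %-digit : ∀ {r} q → r < b → (r + q * b) % b ≡ r
  %-digit {r} q r<b = trans ([m+kn]%n≡m%n r q b) (m<n⇒m%n≡m r<b)

  /-digit : ∀ {r} q → r < b → (r + q * b) / b ≡ q
  /-digit {r} q r<b = trans (+-distrib-/-∣ʳ r (n∣m*n q)) (cong₂ _+_ (m<n⇒m/n≡0 r<b) (m*n/n≡m q b))

  S-digit : ∀ {r} q → r < b → S b (r + q * b) ≡ r + S b q
  S-digit {r} q r<b = trans (S-step (r + q * b)) (cong₂ (λ x y → x + S b y) (%-digit q r<b) (/-digit q r<b))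

  Scount-digit : ∀ d {r} q → r < b → Scount b (suc d) (r + q * b) ≡ δ (suc d) r + Scount b (suc d) q
  Scount-digit d {r} q r<b =
    trans (Scount-step d (r + q * b))
          (cong₂ (λ x y → δ (suc d) x + Scount b (suc d) y) (%-digit q r<b) (/-digit q r<b))

  by-digits : ∀ {p} (P : ℕ → Set p) → (∀ r q → r < b → P (r + q * b)) → ∀ n → P n
  by-digits P f n = subst P (sym (m≡m%n+[m/n]*n n b)) (f (n % b) (n / b) (m%n<n n b))

  digit-rec : ∀ {p} (P : ℕ → Set p) → P 0 → (∀ r q → r < b → P q → P (r + q * b)) → ∀ n → P n
  digit-rec P P0 step = <-rec P go
    where
    go : ∀ n → (∀ {m} → m < n → P m) → P n
    go zero    _   = P0
    go (suc n) rec = subst P (sym (m≡m%n+[m/n]*n (suc n) b))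
      (step (suc n % b) (suc n / b) (m%n<n (suc n) b) (rec (m/n<m (suc n) b 1<b)))

  quotients-≤ : ∀ {s} m n → m + n ≤ suc s → m / b + n / b ≤ s
  quotients-≤ zero    zero    _  = z≤n
  quotients-≤ zero    (suc n) le = ≤-pred (≤-trans (m/n<m (suc n) b 1<b) le)
  quotients-≤ (suc m) n       le = ≤-pred (≤-trans (+-mono-<-≤ (m/n<m (suc m) b 1<b) (m/n≤m n b)) le)

  -- The carry-in c ≤ 1 makes the induction go through: a carry out of the last digit is the carry-in
  -- for the quotients.
  S-subadditive-step : ∀ c {i j} m n → c ≤ 1 → i < b → j < b →
                       (∀ c′ → c′ ≤ 1 → S b (c′ + m + n) ≤ c′ + (S b m + S b n)) →
                       S b (c + (i + m * b) + (j + n * b)) ≤ c + (S b (i + m * b) + S b (j + n * b))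
  S-subadditive-step c {i} {j} m n c≤1 i<b j<b IH with c + i + j <? b
  ... | yes t<b = begin
    S b (c + (i + m * b) + (j + n * b)) ≡⟨ cong (S b) (split c i j m n) ⟩
    S b (t + (m + n) * b)               ≡⟨ S-digit (m + n) t<b ⟩
    t + S b (m + n)                     ≤⟨ +-monoʳ-≤ t (IH 0 z≤n) ⟩
    t + (S b m + S b n)                 ≡⟨ regroup c i j (S b m) (S b n) ⟩
    c + ((i + S b m) + (j + S b n))     ≡⟨ cong (c +_) (sym (cong₂ _+_ (S-digit m i<b) (S-digit n j<b))) ⟩
    c + (S b (i + m * b) + S b (j + n * b)) ∎
    where
    open ≤-Reasoning
    t = c + i + j
  ... | no t≮b = begin
    S b (c + (i + m * b) + (j + n * b)) ≡⟨ cong (S b) (split c i j m n) ⟩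
    S b (t + (m + n) * b)               ≡⟨ cong (λ x → S b (x + (m + n) * b)) u+b≡t ⟨
    S b ((u + b) + (m + n) * b)         ≡⟨ cong (S b) (+-assoc u b ((m + n) * b)) ⟩
    S b (u + (1 + m + n) * b)           ≡⟨ S-digit (1 + m + n) u<b ⟩
    u + S b (1 + m + n)                 ≤⟨ +-monoʳ-≤ u (IH 1 ≤-refl) ⟩
    u + suc (S b m + S b n)             ≡⟨ +-suc u _ ⟩
    suc u + (S b m + S b n)             ≤⟨ +-monoˡ-≤ _ 1+u≤t ⟩
    t + (S b m + S b n)                 ≡⟨ regroup c i j (S b m) (S b n) ⟩
    c + ((i + S b m) + (j + S b n))     ≡⟨ cong (c +_) (sym (cong₂ _+_ (S-digit m i<b) (S-digit n j<b))) ⟩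
    c + (S b (i + m * b) + S b (j + n * b)) ∎
    where
    open ≤-Reasoning
    t = c + i + j
    u = t ∸ b
    u+b≡t : u + b ≡ t
    u+b≡t = m∸n+n≡m (≮⇒≥ t≮b)
    1+u≤t : suc u ≤ t
    1+u≤t = subst (suc u ≤_) u+b≡t (subst (_≤ u + b) (+-comm u 1) (+-monoʳ-≤ u (<⇒≤ 1<b)))
    u<b : u < b
    u<b = +-cancelʳ-< b u b (subst (_< b + b) (sym u+b≡t) (+-mono-≤-< (≤-trans (+-monoˡ-≤ i c≤1) i<b) j<b))

  S-subadditive : ∀ c m n → c ≤ 1 → S b (c + m + n) ≤ c + (S b m + S b n)
  S-subadditive c m n = go (m + n) c m n ≤-refl
    where
    go : ∀ s c m n → m + n ≤ s → c ≤ 1 → S b (c + m + n) ≤ c + (S b m + S b n)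
    go zero    .0 zero    zero    _  z≤n       = z≤n
    go zero    .1 zero    zero    _  (s≤s z≤n) = ≤-refl
    go zero    c  zero    (suc n) ()
    go zero    c  (suc m) n       ()
    go (suc s) c  m       n       le c≤1       = by-digits Pm stepm m n le
      where
      Pm : ℕ → Set
      Pm m = ∀ n → m + n ≤ suc s → S b (c + m + n) ≤ c + (S b m + S b n)
      stepm : ∀ i m′ → i < b → Pm (i + m′ * b)
      stepm i m′ i<b = by-digits _ λ j n′ j<b le →
        S-subadditive-step c m′ n′ c≤1 i<b j<b λ c′ c′≤1 →
          go s c′ m′ n′ (subst₂ (λ x y → x + y ≤ s) (/-digit m′ i<b) (/-digit n′ j<b)
                                (quotients-≤ (i + m′ * b) (j + n′ * b) le)) c′≤1

  -- By Kummer's theorem, this says that adding k and n ∸ k in base b produces no carry.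
  NoCarry : ℕ → ℕ → Set
  NoCarry n k = S b k + S b (n ∸ k) ≡ S b n

  NoCarry? : ∀ n k → Dec (NoCarry n k)
  NoCarry? n k = S b k + S b (n ∸ k) ≟ S b n

  ∸-digits : ∀ {r q j k′} → j ≤ r → k′ ≤ q →
             (r + q * b) ∸ (j + k′ * b) ≡ (r ∸ j) + (q ∸ k′) * b
  ∸-digits {r} {q} {j} {k′} j≤r k′≤q = ∸-by-+ (j + k′ * b) (begin
    (j + k′ * b) + ((r ∸ j) + (q ∸ k′) * b)
      ≡⟨ digits-+ j k′ (r ∸ j) (q ∸ k′) ⟩
    (j + (r ∸ j)) + (k′ + (q ∸ k′)) * b
      ≡⟨ cong₂ (λ x y → x + y * b) (m+[n∸m]≡n j≤r) (m+[n∸m]≡n k′≤q) ⟩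
    r + q * b ∎)
    where open ≡-Reasoning

  ∸-borrow : ∀ {r q j k′} → j ≤ b + r → k′ < q →
             (r + q * b) ∸ (j + k′ * b) ≡ (b + r ∸ j) + (q ∸ suc k′) * b
  ∸-borrow {r} {q} {j} {k′} j≤b+r k′<q = ∸-by-+ (j + k′ * b) (begin
    (j + k′ * b) + ((b + r ∸ j) + d * b) ≡⟨ digits-+ j k′ (b + r ∸ j) d ⟩
    (j + (b + r ∸ j)) + (k′ + d) * b     ≡⟨ cong (_+ (k′ + d) * b) (m+[n∸m]≡n j≤b+r) ⟩
    (b + r) + (k′ + d) * b               ≡⟨ cong (_+ (k′ + d) * b) (+-comm b r) ⟩
    (r + b) + (k′ + d) * b               ≡⟨ +-assoc r b ((k′ + d) * b) ⟩
    r + (suc k′ + d) * b                 ≡⟨ cong (λ x → r + x * b) (m+[n∸m]≡n k′<q) ⟩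
    r + q * b                            ∎)
    where
    open ≡-Reasoning
    d = q ∸ suc k′

  quotient-≤ : ∀ {r q j k′} → r < b → j < b → j + k′ * b ≤ r + q * b → k′ ≤ q
  quotient-≤ {r} {q} {j} {k′} r<b j<b k≤n = subst₂ _≤_ (/-digit k′ j<b) (/-digit q r<b) (/-monoˡ-≤ b k≤n)

  ≤-digits : ∀ {r q j k′} → r < b → j < b → j + k′ * b ≤ r + q * b →
             (j ≤ r × k′ ≤ q) ⊎ (r < j × k′ < q)
  ≤-digits {r} {q} {j} {k′} r<b j<b k≤n with j ≤? r | m≤n⇒m<n∨m≡n (quotient-≤ r<b j<b k≤n)
  ... | yes j≤r | _         = inj₁ (j≤r , quotient-≤ r<b j<b k≤n)
  ... | no  j≰r | inj₁ k′<q = inj₂ (≰⇒> j≰r , k′<q)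
  ... | no  j≰r | inj₂ refl = ⊥-elim (j≰r (+-cancelʳ-≤ (k′ * b) j r k≤n))

  S-∸-digits : ∀ {r q j k′} → j ≤ r → k′ ≤ q → r < b →
               S b ((r + q * b) ∸ (j + k′ * b)) ≡ (r ∸ j) + S b (q ∸ k′)
  S-∸-digits {r} {q} {j} {k′} j≤r k′≤q r<b =
    trans (cong (S b) (∸-digits j≤r k′≤q)) (S-digit (q ∸ k′) (≤-<-trans (m∸n≤m r j) r<b))

  S+S∸-digits : ∀ {r q j k′} → j ≤ r → k′ ≤ q → r < b →
               S b (j + k′ * b) + S b ((r + q * b) ∸ (j + k′ * b)) ≡ r + (S b k′ + S b (q ∸ k′))
  S+S∸-digits {r} {q} {j} {k′} j≤r k′≤q r<b = begin
    S b (j + k′ * b) + S b ((r + q * b) ∸ (j + k′ * b))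
      ≡⟨ cong₂ _+_ (S-digit k′ (≤-<-trans j≤r r<b)) (S-∸-digits j≤r k′≤q r<b) ⟩
    (j + S b k′) + ((r ∸ j) + S b (q ∸ k′))
      ≡⟨ +-interchange j (S b k′) (r ∸ j) (S b (q ∸ k′)) ⟩
    (j + (r ∸ j)) + (S b k′ + S b (q ∸ k′))
      ≡⟨ cong (_+ (S b k′ + S b (q ∸ k′))) (m+[n∸m]≡n j≤r) ⟩
    r + (S b k′ + S b (q ∸ k′)) ∎
    where open ≡-Reasoning

  NoCarry-digits : ∀ {r q j k′} → j ≤ r → k′ ≤ q → r < b →
                   NoCarry (r + q * b) (j + k′ * b) ⇔ NoCarry q k′
  NoCarry-digits {r} {q} j≤r k′≤q r<b = mk⇔
    (λ nc → +-cancelˡ-≡ r _ _ (trans (sym (S+S∸-digits j≤r k′≤q r<b)) (trans nc (S-digit q r<b))))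
    (λ nc → trans (S+S∸-digits j≤r k′≤q r<b) (trans (cong (r +_) nc) (sym (S-digit q r<b))))

  borrow⇒¬NoCarry : ∀ {r q j k′} → r < j → j < b → k′ < q → ¬ NoCarry (r + q * b) (j + k′ * b)
  borrow⇒¬NoCarry {r} {q} {j} {k′} r<j j<b k′<q nc = <⇒≱ 1<b (+-cancelʳ-≤ (r + X) b 1 (begin
    b + (r + X)                                         ≡⟨ sym (+-assoc b r X) ⟩
    (b + r) + X                                         ≡⟨ cong (_+ X) (sym j+u≡b+r) ⟩
    (j + u) + X                                         ≡⟨ +-interchange j u (S b k′) (S b d) ⟩
    (j + S b k′) + (u + S b d)                          ≡⟨ cong₂ _+_ (S-digit k′ j<b) S[n∸k]≡u+S[d] ⟨
    S b (j + k′ * b) + S b ((r + q * b) ∸ (j + k′ * b)) ≡⟨ nc ⟩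
    S b (r + q * b)                                     ≡⟨ S-digit q (<-trans r<j j<b) ⟩
    r + S b q                                           ≡⟨ cong (λ x → r + S b x) (sym (m+[n∸m]≡n k′<q)) ⟩
    r + S b (1 + k′ + d)                                ≤⟨ +-monoʳ-≤ r (S-subadditive 1 k′ d ≤-refl) ⟩
    r + (1 + X)                                         ≡⟨ +-suc r X ⟩
    1 + (r + X)                                         ∎))
    where
    open ≤-Reasoning
    d = q ∸ suc k′
    u = b + r ∸ j
    X = S b k′ + S b d
    j≤b+r : j ≤ b + r
    j≤b+r = ≤-trans (<⇒≤ j<b) (m≤m+n b r)
    j+u≡b+r : j + u ≡ b + r
    j+u≡b+r = m+[n∸m]≡n j≤b+r
    u<b : u < b
    u<b = +-cancelˡ-< j u b (subst (_< j + b) (sym j+u≡b+r) (subst (b + r <_) (+-comm b j) (+-monoʳ-< b r<j)))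
    S[n∸k]≡u+S[d] : S b ((r + q * b) ∸ (j + k′ * b)) ≡ u + S b d
    S[n∸k]≡u+S[d] = trans (cong (S b) (∸-borrow j≤b+r k′<q)) (S-digit d u<b)

  ∸-∸-+ : ∀ m n d a d′ a′ → d + d′ ≤ m → a + a′ ≤ n →
          (m + n) ∸ (d + a) ∸ (d′ + a′) ≡ (m ∸ d ∸ d′) + (n ∸ a ∸ a′)
  ∸-∸-+ m n d a d′ a′ dd′≤m aa′≤n = begin
    (m + n) ∸ (d + a) ∸ (d′ + a′)     ≡⟨ ∸-+-assoc (m + n) (d + a) (d′ + a′) ⟩
    (m + n) ∸ ((d + a) + (d′ + a′))   ≡⟨ cong ((m + n) ∸_) (+-interchange d a d′ a′) ⟩
    (m + n) ∸ ((d + d′) + (a + a′))   ≡⟨ ∸-+-assoc (m + n) (d + d′) (a + a′) ⟨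
    (m + n) ∸ (d + d′) ∸ (a + a′)     ≡⟨ cong (_∸ (a + a′)) (+-∸-comm n dd′≤m) ⟩
    (m ∸ (d + d′) + n) ∸ (a + a′)     ≡⟨ +-∸-assoc (m ∸ (d + d′)) aa′≤n ⟩
    (m ∸ (d + d′)) + (n ∸ (a + a′))   ≡⟨ cong₂ _+_ (∸-+-assoc m d d′) (∸-+-assoc n a a′) ⟨
    (m ∸ d ∸ d′) + (n ∸ a ∸ a′)       ∎
    where open ≡-Reasoning

  -- The counted digit is suc d: zero is not a digit of 0, so Scount b 0 is not additive over r + q * b.
  module DigitCount (d : ℕ)
    (δ-superadditive : ∀ {j r} → j ≤ r → r < b → δ (suc d) j + δ (suc d) (r ∸ j) ≤ δ (suc d) r) where

    δ′ : ℕ → ℕ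
    δ′ = δ (suc d)

    C : ℕ → ℕ
    C = Scount b (suc d)

    Scount-∸-digits : ∀ {r q j k′} → j ≤ r → k′ ≤ q → r < b →
                      C ((r + q * b) ∸ (j + k′ * b)) ≡ δ′ (r ∸ j) + C (q ∸ k′)
    Scount-∸-digits {r} {q} {j} {k′} j≤r k′≤q r<b =
      trans (cong C (∸-digits j≤r k′≤q)) (Scount-digit d (q ∸ k′) (≤-<-trans (m∸n≤m r j) r<b))

    Scount-NoCarry-≤ : ∀ n k → k ≤ n → NoCarry n k → C k + C (n ∸ k) ≤ C n
    Scount-NoCarry-≤ = digit-rec P (λ { .0 z≤n _ → z≤n }) step
      where
      P : ℕ → Set
      P n = ∀ k → k ≤ n → NoCarry n k → C k + C (n ∸ k) ≤ C n
      step : ∀ r q → r < b → P q → P (r + q * b)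
      step r q r<b IH = by-digits _ λ j k′ j<b k≤n nc →
        [ (λ (j≤r , k′≤q) → noBorrow {j} {k′} j≤r k′≤q j<b nc)
        , (λ (r<j , k′<q) → ⊥-elim (borrow⇒¬NoCarry r<j j<b k′<q nc))
        ]′ (≤-digits r<b j<b k≤n)
        where
        noBorrow : ∀ {j k′} → j ≤ r → k′ ≤ q → j < b → NoCarry (r + q * b) (j + k′ * b) →
                   C (j + k′ * b) + C ((r + q * b) ∸ (j + k′ * b)) ≤ C (r + q * b)
        noBorrow {j} {k′} j≤r k′≤q j<b nc = begin
          C (j + k′ * b) + C ((r + q * b) ∸ (j + k′ * b))
            ≡⟨ cong₂ _+_ (Scount-digit d k′ j<b) (Scount-∸-digits j≤r k′≤q r<b) ⟩
          (δ′ j + C k′) + (δ′ (r ∸ j) + C (q ∸ k′))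
            ≡⟨ +-interchange (δ′ j) (C k′) (δ′ (r ∸ j)) (C (q ∸ k′)) ⟩
          (δ′ j + δ′ (r ∸ j)) + (C k′ + C (q ∸ k′))
            ≤⟨ +-mono-≤ (δ-superadditive j≤r r<b)
                        (IH k′ k′≤q (Equivalence.to (NoCarry-digits j≤r k′≤q r<b) nc)) ⟩
          δ′ r + C q
            ≡⟨ Scount-digit d q r<b ⟨
          C (r + q * b) ∎
          where open ≤-Reasoning

    Scount-excess-digits : ∀ {r q j k′} → j ≤ r → k′ ≤ q → r < b → NoCarry q k′ →
      C (r + q * b) ∸ C (j + k′ * b) ∸ C ((r + q * b) ∸ (j + k′ * b))
        ≡ (δ′ r ∸ δ′ j ∸ δ′ (r ∸ j)) + (C q ∸ C k′ ∸ C (q ∸ k′))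
    Scount-excess-digits {r} {q} {j} {k′} j≤r k′≤q r<b nc = begin
      C (r + q * b) ∸ C (j + k′ * b) ∸ C ((r + q * b) ∸ (j + k′ * b))
        ≡⟨ cong₂ _∸_ (cong₂ _∸_ (Scount-digit d q r<b) (Scount-digit d k′ (≤-<-trans j≤r r<b)))
                     (Scount-∸-digits j≤r k′≤q r<b) ⟩
      (δ′ r + C q) ∸ (δ′ j + C k′) ∸ (δ′ (r ∸ j) + C (q ∸ k′))
        ≡⟨ ∸-∸-+ (δ′ r) (C q) (δ′ j) (C k′) (δ′ (r ∸ j)) (C (q ∸ k′))
                 (δ-superadditive j≤r r<b) (Scount-NoCarry-≤ q k′ k′≤q nc) ⟩
      (δ′ r ∸ δ′ j ∸ δ′ (r ∸ j)) + (C q ∸ C k′ ∸ C (q ∸ k′)) ∎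
      where open ≡-Reasoning

δ₂-superadditive : ∀ {j r} → j ≤ r → r < 3 → δ 2 j ℕ.+ δ 2 (r ∸ j) ≤ δ 2 r
δ₂-superadditive {0} {0} _ _ = z≤n
δ₂-superadditive {0} {1} _ _ = z≤n
δ₂-superadditive {0} {2} _ _ = s≤s z≤n
δ₂-superadditive {1} {1} _ _ = z≤n
δ₂-superadditive {1} {2} _ _ = z≤n
δ₂-superadditive {2} {2} _ _ = s≤s z≤n
δ₂-superadditive {suc _}             {0} ()              _
δ₂-superadditive {suc (suc _)}       {1} (s≤s ())        _
δ₂-superadditive {suc (suc (suc _))} {2} (s≤s (s≤s ())) _
δ₂-superadditive {_} {suc (suc (suc _))} _ (s≤s (s≤s (s≤s ())))

module DigitalBinomial {c ℓ : Level} (R : CommutativeRing c ℓ) where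
  open CommutativeRing R
  open import Relation.Binary.Reasoning.Setoid setoid
  open import Algebra.Properties.CommutativeSemigroup *-commutativeSemigroup using (interchange)
  open import Tactic.RingSolver.NonReflective (fromCommutativeRing R (λ _ → nothing))
    using (solve; _⊜_; _⊕_; _⊗_)
  import Data.Nat.Properties as ℕₚ

  pow-+ : ∀ x m n → pow R x (m ℕ.+ n) ≈ pow R x m * pow R x n
  pow-+ x zero    n = sym (*-identityˡ _)
  pow-+ x (suc m) n = trans (*-congˡ (pow-+ x m n)) (sym (*-assoc _ _ _))

  ∑ : ℕ → (ℕ → Carrier) → Carrier
  ∑ zero    f = 0#
  ∑ (suc n) f = f 0 + ∑ n (f ∘ suc)

  ∑-cong : ∀ n {f g} → (∀ {i} → i < n → f i ≈ g i) → ∑ n f ≈ ∑ n g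
  ∑-cong zero    f≈g = refl
  ∑-cong (suc n) f≈g = +-cong (f≈g (s≤s z≤n)) (∑-cong n (f≈g ∘ s≤s))

  ∑-zero : ∀ n {f} → (∀ {i} → i < n → f i ≈ 0#) → ∑ n f ≈ 0#
  ∑-zero zero    f≈0 = refl
  ∑-zero (suc n) f≈0 = trans (+-cong (f≈0 (s≤s z≤n)) (∑-zero n (f≈0 ∘ s≤s))) (+-identityˡ 0#)

  ∑-+ : ∀ m n f → ∑ (m ℕ.+ n) f ≈ ∑ m f + ∑ n (λ i → f (m ℕ.+ i))
  ∑-+ zero    n f = sym (+-identityˡ _)
  ∑-+ (suc m) n f = trans (+-congˡ (∑-+ m n (f ∘ suc))) (sym (+-assoc _ _ _))

  ∑-snoc : ∀ n f → ∑ (suc n) f ≈ ∑ n f + f n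
  ∑-snoc n f = begin
    ∑ (suc n) f               ≡⟨ ≡.cong (λ m → ∑ m f) (ℕₚ.+-comm 1 n) ⟩
    ∑ (n ℕ.+ 1) f             ≈⟨ ∑-+ n 1 f ⟩
    ∑ n f + (f (n ℕ.+ 0) + 0#) ≈⟨ +-congˡ (+-identityʳ _) ⟩
    ∑ n f + f (n ℕ.+ 0)       ≡⟨ ≡.cong (λ i → ∑ n f + f i) (ℕₚ.+-comm n 0) ⟩
    ∑ n f + f n               ∎

  ∑-*ʳ : ∀ n f x → ∑ n f * x ≈ ∑ n (λ i → f i * x)
  ∑-*ʳ zero    f x = zeroˡ x
  ∑-*ʳ (suc n) f x = trans (distribʳ x _ _) (+-congˡ (∑-*ʳ n (f ∘ suc) x))

  ∑-*ˡ : ∀ n f x → x * ∑ n f ≈ ∑ n (λ i → x * f i)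
  ∑-*ˡ zero    f x = zeroʳ x
  ∑-*ˡ (suc n) f x = trans (distribˡ x _ _) (+-congˡ (∑-*ˡ n (f ∘ suc) x))

  ∑-truncate : ∀ {m n} f → m ≤ n → (∀ {i} → m ≤ i → i < n → f i ≈ 0#) → ∑ n f ≈ ∑ m f
  ∑-truncate {m} {n} f m≤n f≈0 = begin
    ∑ n f                                 ≡⟨ ≡.cong (λ l → ∑ l f) (ℕₚ.m+[n∸m]≡n m≤n) ⟨
    ∑ (m ℕ.+ (n ∸ m)) f                   ≈⟨ ∑-+ m (n ∸ m) f ⟩
    ∑ m f + ∑ (n ∸ m) (λ i → f (m ℕ.+ i)) ≈⟨ +-congˡ (∑-zero (n ∸ m) tail≈0) ⟩
    ∑ m f + 0#                            ≈⟨ +-identityʳ _ ⟩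
    ∑ m f                                 ∎
    where
    tail≈0 : ∀ {i} → i < n ∸ m → f (m ℕ.+ i) ≈ 0#
    tail≈0 {i} i<n∸m =
      f≈0 (ℕₚ.m≤m+n m i) (≡.subst (m ℕ.+ i <_) (ℕₚ.m+[n∸m]≡n m≤n) (ℕₚ.+-monoʳ-< m i<n∸m))

  ∑-blocks : ∀ b q f → ∑ (q ℕ.* b) f ≈ ∑ q (λ k′ → ∑ b (λ j → f (k′ ℕ.* b ℕ.+ j)))
  ∑-blocks b zero    f = refl
  ∑-blocks b (suc q) f = begin
    ∑ (b ℕ.+ q ℕ.* b) f
      ≈⟨ ∑-+ b (q ℕ.* b) f ⟩
    ∑ b f + ∑ (q ℕ.* b) (λ i → f (b ℕ.+ i))
      ≈⟨ +-congˡ (∑-blocks b q (λ i → f (b ℕ.+ i))) ⟩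
    ∑ b f + ∑ q (λ k′ → ∑ b (λ j → f (b ℕ.+ (k′ ℕ.* b ℕ.+ j))))
      ≈⟨ +-congˡ (∑-cong q λ _ → ∑-cong b λ _ → reflexive (≡.cong f (≡.sym (ℕₚ.+-assoc b _ _)))) ⟩
    ∑ (suc q) (λ k′ → ∑ b (λ j → f (k′ ℕ.* b ℕ.+ j))) ∎

  ∑-digits : ∀ b r q f → r < b →
             (∀ {j k′} → r < j → j < b → k′ < q → f (j ℕ.+ k′ ℕ.* b) ≈ 0#) →
             ∑ (suc (r ℕ.+ q ℕ.* b)) f ≈ ∑ (suc q) (λ k′ → ∑ (suc r) (λ j → f (j ℕ.+ k′ ℕ.* b)))
  ∑-digits b r q f r<b borrow≈0 = begin
    ∑ (suc (r ℕ.+ q ℕ.* b)) f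
      ≡⟨ ≡.cong (λ m → ∑ m f) (ℕₚ.+-comm (suc r) (q ℕ.* b)) ⟩
    ∑ (q ℕ.* b ℕ.+ suc r) f
      ≈⟨ ∑-+ (q ℕ.* b) (suc r) f ⟩
    ∑ (q ℕ.* b) f + ∑ (suc r) (λ j → f (q ℕ.* b ℕ.+ j))
      ≈⟨ +-cong (∑-blocks b q f) (∑-cong (suc r) λ {j} _ → f-comm q j) ⟩
    ∑ q (λ k′ → ∑ b (λ j → f (k′ ℕ.* b ℕ.+ j))) + G q
      ≈⟨ +-congʳ (∑-cong q lowerBlock) ⟩
    ∑ q G + G q
      ≈⟨ ∑-snoc q G ⟨
    ∑ (suc q) G ∎
    where
    G : ℕ → Carrier
    G k′ = ∑ (suc r) (λ j → f (j ℕ.+ k′ ℕ.* b))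
    f-comm : ∀ k′ j → f (k′ ℕ.* b ℕ.+ j) ≈ f (j ℕ.+ k′ ℕ.* b)
    f-comm k′ j = reflexive (≡.cong f (ℕₚ.+-comm (k′ ℕ.* b) j))
    lowerBlock : ∀ {k′} → k′ < q → ∑ b (λ j → f (k′ ℕ.* b ℕ.+ j)) ≈ G k′
    lowerBlock {k′} k′<q = trans
      (∑-truncate _ r<b λ {j} r<j j<b → trans (f-comm k′ j) (borrow≈0 r<j j<b k′<q))
      (∑-cong (suc r) λ {j} _ → f-comm k′ j)

  when : {A : Set} → Dec A → Carrier → Carrier
  when a x = if does a then x else 0#

  when-no : ∀ {A : Set} (a : Dec A) {x} → ¬ A → when a x ≈ 0#
  when-no (yes a) ¬a = ⊥-elim (¬a a)
  when-no (no _)  _  = refl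

  when-cong : ∀ {A B : Set} (a : Dec A) (b : Dec B) {x y} → A ⇔ B → (B → x ≈ y) → when a x ≈ when b y
  when-cong (yes a) (yes b) _   x≈y = x≈y b
  when-cong (yes a) (no ¬b) A⇔B _   = ⊥-elim (¬b (Equivalence.to A⇔B a))
  when-cong (no ¬a) (yes b) A⇔B _   = ⊥-elim (¬a (Equivalence.from A⇔B b))
  when-cong (no _)  (no _)  _   _   = refl

  when-*ˡ : ∀ {A : Set} (a : Dec A) z x → when a (z * x) ≈ z * when a x
  when-*ˡ (yes _) z x = refl
  when-*ˡ (no _)  z x = sym (zeroʳ z)

  ringSum-filter : ∀ {P : ℕ → Set} (P? : ∀ k → Dec (P k)) f g n →
                   ringSum R (map f (filter P? (applyUpTo g n))) ≈ ∑ n (λ k → when (P? (g k)) (f (g k)))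
  ringSum-filter P? f g zero    = refl
  ringSum-filter P? f g (suc n) with does (P? (g 0))
  ... | true  = +-congˡ (ringSum-filter P? f (g ∘ suc) n)
  ... | false = trans (ringSum-filter P? f (g ∘ suc) n) (sym (+-identityˡ _))

  monomial : Carrier → Carrier → ℕ → ℕ → Carrier
  monomial X Y m l = pow R X m * pow R Y l

  monomial-+ : ∀ X Y m m′ l l′ →
               monomial X Y (m ℕ.+ m′) (l ℕ.+ l′) ≈ monomial X Y m l * monomial X Y m′ l′
  monomial-+ X Y m m′ l l′ = trans (*-cong (pow-+ X m m′) (pow-+ Y l l′)) (interchange _ _ _ _)

  ∑-monomial-≤1 : ∀ X Y {r} → r ≤ 1 → ∑ (suc r) (λ j → monomial X Y j (r ∸ j)) ≈ pow R (X + Y) r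
  ∑-monomial-≤1 X Y z≤n       = trans (+-identityʳ _) (*-identityˡ 1#)
  ∑-monomial-≤1 X Y (s≤s z≤n) = begin
    1# * (Y * 1#) + ((X * 1#) * 1# + 0#)
      ≈⟨ +-cong (trans (*-identityˡ _) (*-identityʳ Y))
                (trans (+-identityʳ _) (trans (*-identityʳ _) (*-identityʳ X))) ⟩
    Y + X        ≈⟨ +-comm Y X ⟩
    X + Y        ≈⟨ *-identityʳ (X + Y) ⟨
    (X + Y) * 1# ∎

  module InBase (k : ℕ) where
    open Digits k public

    monomial-digits : ∀ X Y {r q j k′} → j ≤ r → k′ ≤ q → r < b →
      monomial X Y (S b (j ℕ.+ k′ ℕ.* b)) (S b ((r ℕ.+ q ℕ.* b) ∸ (j ℕ.+ k′ ℕ.* b)))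
        ≈ monomial X Y j (r ∸ j) * monomial X Y (S b k′) (S b (q ∸ k′))
    monomial-digits X Y {r} {q} {j} {k′} j≤r k′≤q r<b = trans
      (reflexive (≡.cong₂ (monomial X Y) (S-digit k′ (ℕₚ.≤-<-trans j≤r r<b)) (S-∸-digits j≤r k′≤q r<b)))
      (monomial-+ X Y j (S b k′) (r ∸ j) (S b (q ∸ k′)))

    module _ (T t : ℕ → ℕ → Carrier) (Z : Carrier)
             (T-zero : T 0 0 ≈ 1#)
             (t-digit : ∀ {r} → r < b → ∑ (suc r) (t r) ≈ pow R Z r)
             (T-digits : ∀ {r q j k′} → j ≤ r → k′ ≤ q → r < b → NoCarry q k′ →
                         T (r ℕ.+ q ℕ.* b) (j ℕ.+ k′ ℕ.* b) ≈ t r j * T q k′) where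

      φ : ℕ → ℕ → Carrier
      φ n k = when (NoCarry? n k) (T n k)

      φ-digits : ∀ {r q j k′} → j ≤ r → k′ ≤ q → r < b →
                 φ (r ℕ.+ q ℕ.* b) (j ℕ.+ k′ ℕ.* b) ≈ t r j * φ q k′
      φ-digits {r} {q} {j} {k′} j≤r k′≤q r<b = trans
        (when-cong (NoCarry? (r ℕ.+ q ℕ.* b) (j ℕ.+ k′ ℕ.* b)) (NoCarry? q k′)
                   (NoCarry-digits j≤r k′≤q r<b) (T-digits j≤r k′≤q r<b))
        (when-*ˡ (NoCarry? q k′) (t r j) (T q k′))

      ∑φ≈pow : ∀ n → ∑ (suc n) (φ n) ≈ pow R Z (S b n)
      ∑φ≈pow = digit-rec _ (trans (+-identityʳ _) T-zero) step
        where
        step : ∀ r q → r < b → ∑ (suc q) (φ q) ≈ pow R Z (S b q) →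
               ∑ (suc (r ℕ.+ q ℕ.* b)) (φ (r ℕ.+ q ℕ.* b)) ≈ pow R Z (S b (r ℕ.+ q ℕ.* b))
        step r q r<b IH = begin
          ∑ (suc n) (φ n)
            ≈⟨ ∑-digits b r q (φ n) r<b borrow≈0 ⟩
          ∑ (suc q) (λ k′ → ∑ (suc r) (λ j → φ n (j ℕ.+ k′ ℕ.* b)))
            ≈⟨ ∑-cong (suc q) (λ {k′} k′<1+q → trans
                 (∑-cong (suc r) λ j<1+r → φ-digits (ℕₚ.≤-pred j<1+r) (ℕₚ.≤-pred k′<1+q) r<b)
                 (sym (∑-*ʳ (suc r) (t r) (φ q k′)))) ⟩
          ∑ (suc q) (λ k′ → ∑ (suc r) (t r) * φ q k′)
            ≈⟨ ∑-*ˡ (suc q) (φ q) _ ⟨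
          ∑ (suc r) (t r) * ∑ (suc q) (φ q)
            ≈⟨ *-cong (t-digit r<b) IH ⟩
          pow R Z r * pow R Z (S b q)
            ≈⟨ pow-+ Z r (S b q) ⟨
          pow R Z (r ℕ.+ S b q)
            ≡⟨ ≡.cong (pow R Z) (S-digit q r<b) ⟨
          pow R Z (S b n) ∎
          where
          n : ℕ
          n = r ℕ.+ q ℕ.* b
          borrow≈0 : ∀ {j k′} → r < j → j < b → k′ < q → φ n (j ℕ.+ k′ ℕ.* b) ≈ 0#
          borrow≈0 {j} {k′} r<j j<b k′<q =
            when-no (NoCarry? n (j ℕ.+ k′ ℕ.* b)) (borrow⇒¬NoCarry r<j j<b k′<q)

      digital-binomial : ∀ n →
        ringSum R (map (T n) (filter (NoCarry? n) (range0to n))) ≈ pow R Z (S b n)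
      digital-binomial n = trans (ringSum-filter (NoCarry? n) (T n) id (suc n)) (∑φ≈pow n)

  digital-binomial-base2 : ∀ n X Y → pow R (X + Y) (S 2 n) ≈
    ringSum R (map (λ k → monomial X Y (S 2 k) (S 2 (n ∸ k)))
      (filter (λ k → S 2 k ℕ.+ S 2 (n ∸ k) ≟ S 2 n) (range0to n)))
  digital-binomial-base2 n X Y = sym (digital-binomial
    (λ n k → monomial X Y (S b k) (S b (n ∸ k))) (λ r j → monomial X Y j (r ∸ j)) (X + Y)
    (*-identityˡ 1#)
    (λ r<2 → ∑-monomial-≤1 X Y (ℕₚ.≤-pred r<2))
    (λ j≤r k′≤q r<b _ → monomial-digits X Y j≤r k′≤q r<b)
    n)
    where open InBase 0

  two-* : ∀ x → two R * x ≈ x + x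
  two-* x = trans (distribʳ x 1# 1#) (+-cong (*-identityˡ x) (*-identityˡ x))

  square-+ : ∀ X Y → Y * Y + ((X * Y + X * Y) + X * X) ≈ (X + Y) * (X + Y)
  square-+ = solve 2 (λ X Y → Y ⊗ Y ⊕ ((X ⊗ Y ⊕ X ⊗ Y) ⊕ X ⊗ X) ⊜ (X ⊕ Y) ⊗ (X ⊕ Y)) refl

  digital-binomial-base3 : ∀ n X Y → pow R (X + Y) (S 3 n) ≈
    ringSum R (map (λ k → pow R (two R) (Scount 3 2 n ∸ Scount 3 2 k ∸ Scount 3 2 (n ∸ k))
                          * monomial X Y (S 3 k) (S 3 (n ∸ k)))
      (filter (λ k → S 3 k ℕ.+ S 3 (n ∸ k) ≟ S 3 n) (range0to n)))
  digital-binomial-base3 n X Y =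
    sym (digital-binomial T t (X + Y) (trans (*-identityˡ _) (*-identityˡ 1#)) t-digit T-digits n)
    where
    open InBase 1
    open DigitCount 1 δ₂-superadditive

    T : ℕ → ℕ → Carrier
    T n k = pow R (two R) (C n ∸ C k ∸ C (n ∸ k)) * monomial X Y (S b k) (S b (n ∸ k))

    t : ℕ → ℕ → Carrier
    t r j = pow R (two R) (δ′ r ∸ δ′ j ∸ δ′ (r ∸ j)) * monomial X Y j (r ∸ j)

    t-digit : ∀ {r} → r < 3 → ∑ (suc r) (t r) ≈ pow R (X + Y) r
    t-digit {0} _ = trans (+-congʳ (*-identityˡ _)) (∑-monomial-≤1 X Y z≤n)
    t-digit {1} _ =
      trans (+-cong (*-identityˡ _) (+-congʳ (*-identityˡ _))) (∑-monomial-≤1 X Y (s≤s z≤n))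
    t-digit {2} _ = begin
      t 2 0 + (t 2 1 + (t 2 2 + 0#))    ≈⟨ +-cong YY (+-cong XY+XY (trans (+-identityʳ _) XX)) ⟩
      Y * Y + ((X * Y + X * Y) + X * X) ≈⟨ square-+ X Y ⟩
      (X + Y) * (X + Y)                 ≈⟨ *-congˡ (*-identityʳ (X + Y)) ⟨
      pow R (X + Y) 2                   ∎
      where
      YY : 1# * (1# * pow R Y 2) ≈ Y * Y
      YY = trans (*-identityˡ _) (trans (*-identityˡ _) (*-congˡ (*-identityʳ Y)))
      XY+XY : (two R * 1#) * ((X * 1#) * (Y * 1#)) ≈ X * Y + X * Y
      XY+XY = trans (*-cong (*-identityʳ (two R)) (*-cong (*-identityʳ X) (*-identityʳ Y))) (two-* (X * Y))
      XX : 1# * (pow R X 2 * 1#) ≈ X * X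
      XX = trans (*-identityˡ _) (trans (*-identityʳ _) (*-congˡ (*-identityʳ X)))
    t-digit {suc (suc (suc _))} (s≤s (s≤s (s≤s ())))

    T-digits : ∀ {r q j k′} → j ≤ r → k′ ≤ q → r < b → NoCarry q k′ →
               T (r ℕ.+ q ℕ.* b) (j ℕ.+ k′ ℕ.* b) ≈ t r j * T q k′
    T-digits {r} {q} {j} {k′} j≤r k′≤q r<b nc = begin
      T m l
        ≡⟨ ≡.cong (λ e → pow R (two R) e * monomial X Y (S b l) (S b (m ∸ l)))
                  (Scount-excess-digits j≤r k′≤q r<b nc) ⟩
      pow R (two R) (eʳ ℕ.+ eq) * monomial X Y (S b l) (S b (m ∸ l))
        ≈⟨ *-cong (pow-+ (two R) eʳ eq) (monomial-digits X Y j≤r k′≤q r<b) ⟩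
      (pow R (two R) eʳ * pow R (two R) eq)
        * (monomial X Y j (r ∸ j) * monomial X Y (S b k′) (S b (q ∸ k′)))
        ≈⟨ interchange _ _ _ _ ⟩
      t r j * T q k′ ∎
      where
      m l eʳ eq : ℕ
      m = r ℕ.+ q ℕ.* b
      l = j ℕ.+ k′ ℕ.* b
      eʳ = δ′ r ∸ δ′ j ∸ δ′ (r ∸ j)
      eq = C q ∸ C k′ ∸ C (q ∸ k′)

open import Data.Nat using (_+_)

corollary3p3 : ∀ {c ℓ : Level} (R : CommutativeRing c ℓ) →
  (∀ (n : ℕ) (X Y : CommutativeRing.Carrier R) →
    CommutativeRing._≈_ R
      (pow R (CommutativeRing._+_ R X Y) (S 2 n))
      (ringSum R (map (λ k → CommutativeRing._*_ R (pow R X (S 2 k)) (pow R Y (S 2 (n ∸ k))))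
        (filter (λ k → S 2 k + S 2 (n ∸ k) ≟ S 2 n) (range0to n)))))
  ×
  (∀ (n : ℕ) (X Y : CommutativeRing.Carrier R) →
    CommutativeRing._≈_ R
      (pow R (CommutativeRing._+_ R X Y) (S 3 n))
      (ringSum R (map (λ k → CommutativeRing._*_ R
            (pow R (two R) (Scount 3 2 n ∸ Scount 3 2 k ∸ Scount 3 2 (n ∸ k)))
            (CommutativeRing._*_ R (pow R X (S 3 k)) (pow R Y (S 3 (n ∸ k)))))
        (filter (λ k → S 3 k + S 3 (n ∸ k) ≟ S 3 n) (range0to n)))))
corollary3p3 R = DigitalBinomial.digital-binomial-base2 R , DigitalBinomial.digital-binomial-base3 R
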